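{- For any $m\in\mathbb{Z}_{>0}$, $$\Gamma(m)=\left\{\mu\in\Lambda(m):\ \text{for all } j\in J_\mu,\ \binom{m}{j}\equiv 0\pmod p\right\},$$ where $J_\mu=\{j\in\mathbb{Z}_{\ge0}: m-\mu_2<j<\mu_1\}$.
   Context: Let $p$ be a prime, $\mathbb{F}=\mathbb{F}_p$, $S=\mathbb{F}[x,y]$, $\mathrm{Der}_S=S\partial_x\oplus S\partial_y$. Let $\mathcal{A}=\{H_1,H_2,H_3\}$ with $H_1=\ker x$, $H_2=\ker y$, $H_3=\ker(x+y)$, $\alpha_1=x,\alpha_2=y,\alpha_3=x+y$. For $\mu=(\mu_1,\mu_2,\mu_3)\in\mathbb{Z}_{\ge0}^3$, $D(\mathcal{A},\mu)=\{\theta\in\mathrm{Der}_S:\theta(\alpha_i)\in\alpha_i^{\mu_i}S,\ i=1,2,3\}$. Let $\Lambda(m)=\{\mu\in\mathbb{Z}_{\ge0}^3:\mu_3=m\}$. For $\mu\in\Lambda(m)$ let $\psi_\mu=\sum_{j=\mu_1}^{m}\binom{m}{j}x^jy^{m-j}\partial_x+\sum_{j=0}^{\mu_1-1}\binom{m}{j}x^jy^{m-j}\partial_y$ (binomial coefficients read in $\mathbb{F}_p$; empty sums are zero) and $\psi'_\mu=x^{\mu_1}y^{\mu_2}(\partial_y-\partial_x)$, and let $\Gamma(m)=\{\mu\in\Lambda(m):\{\psi_\mu,\psi'_\mu\}\text{ is a basis for }D(\mathcal{A},\mu)\}$. -}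

module Defs where

open import Data.Nat as ℕ using (ℕ; zero; suc; _∸_; _≡ᵇ_)
open import Data.Nat.Combinatorics using (_C_)
open import Data.Bool using (Bool; true; false; _∧_; if_then_else_)
open import Data.Integer as ℤ using (ℤ; +_; 0ℤ; 1ℤ)
open import Data.Integer.Divisibility as ℤD using ()
open import Data.Product using (Σ; _×_; _,_; ∃)
open import Relation.Binary.PropositionalEquality using (_≡_)

-- Elements of S = F_p[x,y] are represented by integer coefficient functions
-- (f i j = coefficient of x^i y^j) with finite support; they are compared
-- modulo p, i.e. S ≅ ℤ[x,y] / p ℤ[x,y].
Poly : Set
Poly = ℕ → ℕ → ℤ

IsPoly : Poly → Set
IsPoly f = ∃ λ N → ∀ i j → N ℕ.< i ℕ.+ j → f i j ≡ 0ℤ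

_≈[_]_ : Poly → ℕ → Poly → Set
f ≈[ p ] g = ∀ i j → (+ p) ℤD.∣ (f i j ℤ.- g i j)

zeroP : Poly
zeroP _ _ = 0ℤ

mono : ℕ → ℕ → Poly
mono a b i j = if (a ≡ᵇ i) ∧ (b ≡ᵇ j) then 1ℤ else 0ℤ

oneP xP yP : Poly
oneP = mono 0 0
xP = mono 1 0
yP = mono 0 1

_+P_ : Poly → Poly → Poly
(f +P g) i j = f i j ℤ.+ g i j

negP : Poly → Poly
negP f i j = ℤ.- f i j

_•_ : ℤ → Poly → Poly
(c • f) i j = c ℤ.* f i j

Σ≤ : ℕ → (ℕ → ℤ) → ℤ
Σ≤ zero h = h 0
Σ≤ (suc n) h = Σ≤ n h ℤ.+ h (suc n)

_*P_ : Poly → Poly → Poly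
(f *P g) i j = Σ≤ i λ a → Σ≤ j λ b → f a b ℤ.* g (i ∸ a) (j ∸ b)

powP : Poly → ℕ → Poly
powP f zero = oneP
powP f (suc k) = f *P powP f k

-- Σ_{k=a}^{b-1} F k   (half-open range [a,b); empty if b ≤ a)
ΣP : ℕ → ℕ → (ℕ → Poly) → Poly
ΣP a b F = go (b ∸ a) a
  where
  go : ℕ → ℕ → Poly
  go zero _ = zeroP
  go (suc n) k = F k +P go n (suc k)

-- Derivations θ = θ₁ ∂x + θ₂ ∂y, stored as (θ₁ , θ₂)
Der : Set
Der = Poly × Poly

IsDer : Der → Set
IsDer (θ₁ , θ₂) = IsPoly θ₁ × IsPoly θ₂

-- θ(α) for α = a x + b y linear form given by polynomial α; we use the three
-- specific forms: θ(x) = θ₁, θ(y) = θ₂, θ(x+y) = θ₁ + θ₂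
θx θy θxy : Der → Poly
θx (θ₁ , θ₂) = θ₁
θy (θ₁ , θ₂) = θ₂
θxy (θ₁ , θ₂) = θ₁ +P θ₂

αxy : Poly
αxy = xP +P yP

InIdeal : ℕ → Poly → ℕ → Poly → Set
InIdeal p α k h = ∃ λ g → IsPoly g × (h ≈[ p ] (powP α k *P g))

InD : ℕ → ℕ → ℕ → ℕ → Der → Set
InD p μ₁ μ₂ μ₃ θ =
  IsDer θ × InIdeal p xP μ₁ (θx θ) × InIdeal p yP μ₂ (θy θ) × InIdeal p αxy μ₃ (θxy θ)

lin : Poly → Der → Poly → Der → Der
lin f (a₁ , a₂) g (b₁ , b₂) = ((f *P a₁) +P (g *P b₁)) , ((f *P a₂) +P (g *P b₂))

_≈D[_]_ : Der → ℕ → Der → Set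
(a₁ , a₂) ≈D[ p ] (b₁ , b₂) = (a₁ ≈[ p ] b₁) × (a₂ ≈[ p ] b₂)

IsBasisD : ℕ → ℕ → ℕ → ℕ → Der → Der → Set
IsBasisD p μ₁ μ₂ μ₃ θ θ' =
  InD p μ₁ μ₂ μ₃ θ × InD p μ₁ μ₂ μ₃ θ' ×
  (∀ η → InD p μ₁ μ₂ μ₃ η →
     ∃ λ f → ∃ λ g → IsPoly f × IsPoly g × (η ≈D[ p ] lin f θ g θ')) ×
  (∀ f g → IsPoly f → IsPoly g → lin f θ g θ' ≈D[ p ] (zeroP , zeroP) →
     (f ≈[ p ] zeroP) × (g ≈[ p ] zeroP))

ψ : ℕ → ℕ → Der
ψ m μ₁ =
  ΣP μ₁ (suc m) (λ k → (+ (m C k)) • mono k (m ∸ k)) ,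
  ΣP 0 μ₁ (λ k → (+ (m C k)) • mono k (m ∸ k))

ψ' : ℕ → ℕ → Der
ψ' μ₁ μ₂ = negP (powP xP μ₁ *P powP yP μ₂) , (powP xP μ₁ *P powP yP μ₂)

InΓ : ℕ → ℕ → ℕ → ℕ → Set
InΓ p m μ₁ μ₂ = IsBasisD p μ₁ μ₂ m (ψ m μ₁) (ψ' μ₁ μ₂)

{-# OPTIONS --safe #-}
-- Polynomials over 𝔽ₚ are coefficient functions compared modulo p, so x^a y^b divides h exactly
-- when the coefficients of h outside the quadrant i ≥ a, j ≥ b vanish mod p.
-- ψ_μ always satisfies the conditions at x and at x + y: ψ₁ lives in x-degrees ≥ μ₁ and
-- ψ₁ + ψ₂ = (x + y)^m. Its condition at y asks that the coefficient binom(m, j) of x^j y^(m-j) in ψ₂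
-- (for j < μ₁) vanish mod p whenever m - j < μ₂, which is exactly the binomial condition.
-- Given it, any θ ∈ D(A, μ) with θ(x + y) = (x + y)^m h differs from h ψ_μ by a derivation killing
-- x + y, whose components are opposite and divisible by x^μ₁ and by y^μ₂ respectively, hence both
-- divisible by x^μ₁ y^μ₂: it is a multiple of ψ'_μ. Finally f ψ_μ + g ψ'_μ = 0 gives f (x + y)^m = 0,
-- so f = 0 since (x + y)^m is y^m on x = 0, and then g = 0.
module Submission where

open import Defs
open import Data.Nat using (ℕ; _>_; _<_)
open import Data.Nat.Divisibility using (_∣_)
open import Data.Nat.Primality using (Prime)
open import Data.Nat.Combinatorics using (_C_)
open import Data.Integer as ℤ using (+_)
open import Function.Bundles using (_⇔_)

open import Algebra.Properties.CommutativeSemigroup as CSemigroupProps using ()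
open import Data.Bool using (true; false; T)
open import Data.Bool.Properties using (T-≡)
open import Data.Empty using (⊥; ⊥-elim)
open import Data.Integer.Divisibility as ℤᵘ using ()
open import Data.Integer.Divisibility.Signed as ℤˢ using (∣ᵤ⇒∣; ∣⇒∣ᵤ)
open import Data.Integer.Properties as ℤP using ()
open import Data.Integer.Tactic.RingSolver using (solve-∀)
open import Data.Nat as ℕ using (zero; suc; _∸_; _≤_; z≤n; s≤s; _≡ᵇ_; _≟_; _≤?_; _<?_)
open import Data.Nat.Combinatorics using (nCn≡1; nCk+nC[k+1]≡[n+1]C[k+1]; k>n⇒nCk≡0)
open import Data.Nat.Divisibility using (_∣0)
open import Data.Nat.Induction using (<-rec)
open import Data.Nat.Properties as ℕP
  using (≤-refl; m≤n⇒m≤1+n; <⇒≢; <⇒≱; ≤∧≢⇒<; ≰⇒>; ≮⇒≥; m+[n∸m]≡n; m∸n+n≡m; m+n∸m≡n)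
open import Data.Product using (_×_; _,_; ∃; proj₁; proj₂)
open import Data.Sum as Sum using (_⊎_; inj₁; inj₂; [_,_])
open import Function.Base using (id; _∘_; _$_; case_of_)
open import Function.Bundles using (mk⇔; Equivalence)
open import Level using (0ℓ)
open import Relation.Binary.Bundles using (Setoid)
import Relation.Binary.Reasoning.Setoid as SetoidReasoning
open import Relation.Binary.PropositionalEquality
  using (_≡_; _≢_; refl; sym; trans; cong; cong₂; subst; subst₂; module ≡-Reasoning)
open import Relation.Nullary using (¬_; Dec; yes; no)
open ℤ using (ℤ; 0ℤ; 1ℤ; _+_; _-_; -_; _*_)

private
  variable
    a b i j k l n : ℕ
    f f′ g g′ h : Poly

-- Finite sums

Σ≤-cong : ∀ n {u v : ℕ → ℤ} → (∀ {k} → k ≤ n → u k ≡ v k) → Σ≤ n u ≡ Σ≤ n v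
Σ≤-cong zero    u≡v = u≡v z≤n
Σ≤-cong (suc n) u≡v = cong₂ _+_ (Σ≤-cong n (u≡v ∘ m≤n⇒m≤1+n)) (u≡v ≤-refl)

Σ≤-zero : ∀ n {u : ℕ → ℤ} → (∀ {k} → k ≤ n → u k ≡ 0ℤ) → Σ≤ n u ≡ 0ℤ
Σ≤-zero zero    u≡0 = u≡0 z≤n
Σ≤-zero (suc n) u≡0 = cong₂ _+_ (Σ≤-zero n (u≡0 ∘ m≤n⇒m≤1+n)) (u≡0 ≤-refl)

Σ≤-single : ∀ n {c} {u : ℕ → ℤ} → c ≤ n → (∀ {k} → k ≤ n → k ≢ c → u k ≡ 0ℤ) →
            Σ≤ n u ≡ u c
Σ≤-single zero    z≤n _ = refl
Σ≤-single (suc n) {c} {u} c≤1+n u≡0 with c ≟ suc n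
... | yes refl = trans (cong (_+ u c) (Σ≤-zero n λ k≤n → u≡0 (m≤n⇒m≤1+n k≤n) (<⇒≢ (s≤s k≤n))))
                       (ℤP.+-identityˡ (u c))
... | no c≢1+n = trans (cong₂ _+_ (Σ≤-single n (ℕ.s≤s⁻¹ (≤∧≢⇒< c≤1+n c≢1+n)) (u≡0 ∘ m≤n⇒m≤1+n))
                                  (u≡0 ≤-refl (c≢1+n ∘ sym)))
                       (ℤP.+-identityʳ (u c))

Σ≤-+ : ∀ n (u v : ℕ → ℤ) → Σ≤ n (λ k → u k + v k) ≡ Σ≤ n u + Σ≤ n v
Σ≤-+ zero    u v = refl
Σ≤-+ (suc n) u v = trans (cong (_+ (u (suc n) + v (suc n))) (Σ≤-+ n u v))
                         (CSemigroupProps.interchange ℤP.+-commutativeSemigroup (Σ≤ n u) (Σ≤ n v) (u (suc n)) (v (suc n)))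

Σ≤-neg : ∀ n (u : ℕ → ℤ) → Σ≤ n (λ k → - u k) ≡ - Σ≤ n u
Σ≤-neg zero    u = refl
Σ≤-neg (suc n) u = trans (cong (_- u (suc n)) (Σ≤-neg n u)) (sym (ℤP.neg-distrib-+ (Σ≤ n u) (u (suc n))))

Σ≤-unfoldˡ : ∀ n (u : ℕ → ℤ) → Σ≤ (suc n) u ≡ u 0 + Σ≤ n (u ∘ suc)
Σ≤-unfoldˡ zero    u = refl
Σ≤-unfoldˡ (suc n) u = trans (cong (_+ u (2 ℕ.+ n)) (Σ≤-unfoldˡ n u)) (ℤP.+-assoc (u 0) _ _)

Σ≤-reverse : ∀ n (u : ℕ → ℤ) → Σ≤ n u ≡ Σ≤ n (λ k → u (n ∸ k))
Σ≤-reverse zero    u = refl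
Σ≤-reverse (suc n) u = begin
  Σ≤ n u + u (suc n)                    ≡⟨ cong (_+ u (suc n)) (Σ≤-reverse n u) ⟩
  Σ≤ n (λ k → u (n ∸ k)) + u (suc n)    ≡⟨ ℤP.+-comm _ (u (suc n)) ⟩
  u (suc n) + Σ≤ n (λ k → u (n ∸ k))    ≡⟨ Σ≤-unfoldˡ n (λ k → u (suc n ∸ k)) ⟨
  Σ≤ (suc n) (λ k → u (suc n ∸ k))      ∎
  where open ≡-Reasoning

-- Polynomial arithmetic

infix 4 _≗₂_
_≗₂_ : Poly → Poly → Set
f ≗₂ g = ∀ i j → f i j ≡ g i j

mono-diag : ∀ a b → mono a b a b ≡ 1ℤ
mono-diag a b
  rewrite Equivalence.to T-≡ (ℕP.≡⇒≡ᵇ a a refl) | Equivalence.to T-≡ (ℕP.≡⇒≡ᵇ b b refl) = refl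

mono-off : ∀ {a b i j} → ¬ (a ≡ i × b ≡ j) → mono a b i j ≡ 0ℤ
mono-off {a} {b} {i} {j} ≢diag with a ≡ᵇ i in a≡ᵇi | b ≡ᵇ j in b≡ᵇj
... | true  | true  =
  ⊥-elim (≢diag (ℕP.≡ᵇ⇒≡ a i (subst T (sym a≡ᵇi) _) , ℕP.≡ᵇ⇒≡ b j (subst T (sym b≡ᵇj) _)))
... | true  | false = refl
... | false | _     = refl

mono-translate : ∀ a b c d k l → mono (a ℕ.+ c) (b ℕ.+ d) (a ℕ.+ k) (b ℕ.+ l) ≡ mono c d k l
mono-translate (suc a) b       c d k l = mono-translate a b c d k l
mono-translate zero    (suc b) c d k l = mono-translate zero b c d k l
mono-translate zero    zero    c d k l = refl

mono-*P-inside : ∀ {a b i j} g → a ≤ i → b ≤ j → (mono a b *P g) i j ≡ g (i ∸ a) (j ∸ b)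
mono-*P-inside {a} {b} {i} {j} g a≤i b≤j = begin
  (mono a b *P g) i j                               ≡⟨ Σ≤-single i a≤i (λ _ k≢a → Σ≤-zero j λ _ → term-off (k≢a ∘ sym ∘ proj₁)) ⟩
  Σ≤ j (λ l → mono a b a l * g (i ∸ a) (j ∸ l))     ≡⟨ Σ≤-single j b≤j (λ _ l≢b → term-off (l≢b ∘ sym ∘ proj₂)) ⟩
  mono a b a b * g (i ∸ a) (j ∸ b)                  ≡⟨ cong (_* g (i ∸ a) (j ∸ b)) (mono-diag a b) ⟩
  1ℤ * g (i ∸ a) (j ∸ b)                            ≡⟨ ℤP.*-identityˡ _ ⟩
  g (i ∸ a) (j ∸ b)                                 ∎
  where
  open ≡-Reasoning
  term-off : ¬ (a ≡ k × b ≡ l) → mono a b k l * g (i ∸ k) (j ∸ l) ≡ 0ℤ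
  term-off ≢diag = cong (_* _) (mono-off ≢diag)

mono-*P-outside : ∀ {a b i j} g → i < a ⊎ j < b → (mono a b *P g) i j ≡ 0ℤ
mono-*P-outside {a} {b} {i} {j} g outside =
  Σ≤-zero i λ k≤i → Σ≤-zero j λ l≤j → cong (_* _) (mono-off (not-diag k≤i l≤j))
  where
  not-diag : k ≤ i → l ≤ j → ¬ (a ≡ k × b ≡ l)
  not-diag k≤i l≤j (refl , refl) = [ (λ i<a → <⇒≱ i<a k≤i) , (λ j<b → <⇒≱ j<b l≤j) ] outside

*P-congˡ : ∀ g → f ≗₂ f′ → f *P g ≗₂ f′ *P g
*P-congˡ g f≗f′ i j = Σ≤-cong i λ {a} _ → Σ≤-cong j λ {b} _ → cong (_* g (i ∸ a) (j ∸ b)) (f≗f′ a b)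

*P-congʳ : ∀ f → g ≗₂ g′ → f *P g ≗₂ f *P g′
*P-congʳ f g≗g′ i j = Σ≤-cong i λ {a} _ → Σ≤-cong j λ {b} _ → cong (f a b *_) (g≗g′ (i ∸ a) (j ∸ b))

*P-comm : ∀ f g → f *P g ≗₂ g *P f
*P-comm f g i j =
  trans (Σ≤-reverse i _) (Σ≤-cong i λ {a} a≤i → trans (Σ≤-reverse j _) (Σ≤-cong j λ {b} b≤j →
    trans (cong₂ (λ a′ b′ → f (i ∸ a) (j ∸ b) * g a′ b′) (ℕP.m∸[m∸n]≡n a≤i) (ℕP.m∸[m∸n]≡n b≤j))
          (ℤP.*-comm (f (i ∸ a) (j ∸ b)) (g a b))))

*P-distribˡ : ∀ f g h → f *P (g +P h) ≗₂ (f *P g) +P (f *P h)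
*P-distribˡ f g h i j =
  trans (Σ≤-cong i λ {a} _ → trans (Σ≤-cong j λ {b} _ → ℤP.*-distribˡ-+ (f a b) _ _) (Σ≤-+ j _ _))
        (Σ≤-+ i _ _)

*P-negʳ : ∀ f g → f *P negP g ≗₂ negP (f *P g)
*P-negʳ f g i j =
  trans (Σ≤-cong i λ {a} _ → trans (Σ≤-cong j λ {b} _ → sym (ℤP.neg-distribʳ-* (f a b) _)) (Σ≤-neg j _))
        (Σ≤-neg i _)

*P-zeroʳ : ∀ f → f *P zeroP ≗₂ zeroP
*P-zeroʳ f i j = Σ≤-zero i λ {a} _ → Σ≤-zero j λ {b} _ → ℤP.*-zeroʳ (f a b)

*P-identityʳ : ∀ f → f *P oneP ≗₂ f
*P-identityʳ f i j = trans (*P-comm f oneP i j) (mono-*P-inside f z≤n z≤n)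

mono-*P-mono : ∀ a b c d → mono a b *P mono c d ≗₂ mono (a ℕ.+ c) (b ℕ.+ d)
mono-*P-mono a b c d i j with a ≤? i | b ≤? j
... | yes a≤i | yes b≤j = begin
  (mono a b *P mono c d) i j                                   ≡⟨ mono-*P-inside (mono c d) a≤i b≤j ⟩
  mono c d (i ∸ a) (j ∸ b)                                     ≡⟨ mono-translate a b c d (i ∸ a) (j ∸ b) ⟨
  mono (a ℕ.+ c) (b ℕ.+ d) (a ℕ.+ (i ∸ a)) (b ℕ.+ (j ∸ b))     ≡⟨ cong₂ (mono (a ℕ.+ c) (b ℕ.+ d)) (m+[n∸m]≡n a≤i) (m+[n∸m]≡n b≤j) ⟩
  mono (a ℕ.+ c) (b ℕ.+ d) i j                                 ∎
  where open ≡-Reasoning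
... | no a≰i | _ = trans (mono-*P-outside {a} {b} {i} {j} (mono c d) (inj₁ (≰⇒> a≰i)))
                         (sym (mono-off {a ℕ.+ c} {b ℕ.+ d} λ (a+c≡i , _) → a≰i (subst (a ≤_) a+c≡i (ℕP.m≤m+n a c))))
... | yes _ | no b≰j = trans (mono-*P-outside {a} {b} {i} {j} (mono c d) (inj₂ (≰⇒> b≰j)))
                             (sym (mono-off {a ℕ.+ c} {b ℕ.+ d} λ (_ , b+d≡j) →
                                     b≰j (subst (b ≤_) b+d≡j (ℕP.m≤m+n b d))))

powP-xP : ∀ k → powP xP k ≗₂ mono k 0
powP-xP zero    i j = refl
powP-xP (suc k) i j = trans (*P-congʳ xP (powP-xP k) i j) (mono-*P-mono 1 0 k 0 i j)

powP-yP : ∀ k → powP yP k ≗₂ mono 0 k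
powP-yP zero    i j = refl
powP-yP (suc k) i j = trans (*P-congʳ yP (powP-yP k) i j) (mono-*P-mono 0 1 0 k i j)

powP-xP-*P-powP-yP : ∀ a b → powP xP a *P powP yP b ≗₂ mono a b
powP-xP-*P-powP-yP a b i j = begin
  (powP xP a *P powP yP b) i j       ≡⟨ *P-congˡ (powP yP b) (powP-xP a) i j ⟩
  (mono a 0 *P powP yP b) i j        ≡⟨ *P-congʳ (mono a 0) (powP-yP b) i j ⟩
  (mono a 0 *P mono 0 b) i j         ≡⟨ mono-*P-mono a 0 0 b i j ⟩
  mono (a ℕ.+ 0) b i j               ≡⟨ cong (λ a′ → mono a′ b i j) (ℕP.+-identityʳ a) ⟩
  mono a b i j                       ∎
  where open ≡-Reasoning

_/x^_y^_ : Poly → ℕ → ℕ → Poly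
(h /x^ a y^ b) i j = h (a ℕ.+ i) (b ℕ.+ j)

IsPoly-resp : f ≗₂ g → IsPoly f → IsPoly g
IsPoly-resp f≗g (N , f-vanishes) = N , λ i j N<i+j → trans (sym (f≗g i j)) (f-vanishes i j N<i+j)

IsPoly-dominated : IsPoly g → (∀ i j → f i j ≡ 0ℤ ⊎ f i j ≡ g i j) → IsPoly f
IsPoly-dominated (N , g-vanishes) 0-or-g = N , λ i j N<i+j →
  [ id , (λ fij≡g → trans fij≡g (g-vanishes i j N<i+j)) ] (0-or-g i j)

IsPoly-mono : ∀ a b → IsPoly (mono a b)
IsPoly-mono a b = a ℕ.+ b , λ i j a+b<i+j → mono-off {a} {b} {i} {j} λ { (refl , refl) → ℕP.<-irrefl refl a+b<i+j }

IsPoly-+P : IsPoly f → IsPoly g → IsPoly (f +P g)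
IsPoly-+P (N , f-vanishes) (M , g-vanishes) = N ℕ.+ M , λ i j N+M<i+j →
  cong₂ _+_ (f-vanishes i j (ℕP.≤-<-trans (ℕP.m≤m+n N M) N+M<i+j))
            (g-vanishes i j (ℕP.≤-<-trans (ℕP.m≤n+m M N) N+M<i+j))

IsPoly-negP : IsPoly f → IsPoly (negP f)
IsPoly-negP (N , f-vanishes) = N , λ i j N<i+j → cong -_ (f-vanishes i j N<i+j)

IsPoly-/x^y^ : IsPoly h → IsPoly (h /x^ a y^ b)
IsPoly-/x^y^ {a = a} {b} (N , h-vanishes) = N , λ i j N<i+j →
  h-vanishes (a ℕ.+ i) (b ℕ.+ j) (ℕP.<-≤-trans N<i+j (ℕP.+-mono-≤ (ℕP.m≤n+m i a) (ℕP.m≤n+m j b)))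

IsPoly-*P : IsPoly f → IsPoly g → IsPoly (f *P g)
IsPoly-*P {f} {g} (N , f-vanishes) (M , g-vanishes) = N ℕ.+ M , λ i j N+M<i+j →
  Σ≤-zero i λ a≤i → Σ≤-zero j λ b≤j → term-vanishes a≤i b≤j N+M<i+j
  where
  term-vanishes : a ≤ i → b ≤ j → N ℕ.+ M < i ℕ.+ j → f a b * g (i ∸ a) (j ∸ b) ≡ 0ℤ
  term-vanishes {a} {i} {b} {j} a≤i b≤j N+M<i+j with N <? a ℕ.+ b
  ... | yes N<a+b = cong (_* g (i ∸ a) (j ∸ b)) (f-vanishes a b N<a+b)
  ... | no  N≮a+b = trans (cong (f a b *_) (g-vanishes (i ∸ a) (j ∸ b) M<rest)) (ℤP.*-zeroʳ (f a b))
    where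
    open ℕP.≤-Reasoning
    M<rest : M < (i ∸ a) ℕ.+ (j ∸ b)
    M<rest = ≰⇒> λ rest≤M → <⇒≱ N+M<i+j $ begin
      i ℕ.+ j                                   ≡⟨ cong₂ ℕ._+_ (m+[n∸m]≡n a≤i) (m+[n∸m]≡n b≤j) ⟨
      (a ℕ.+ (i ∸ a)) ℕ.+ (b ℕ.+ (j ∸ b))       ≡⟨ CSemigroupProps.interchange ℕP.+-commutativeSemigroup a (i ∸ a) b (j ∸ b) ⟩
      (a ℕ.+ b) ℕ.+ ((i ∸ a) ℕ.+ (j ∸ b))       ≤⟨ ℕP.+-mono-≤ (≮⇒≥ N≮a+b) rest≤M ⟩
      N ℕ.+ M                                   ∎

-- (x + y)^m and ψ_μ

binomialTerm : ℕ → ℕ → Poly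
binomialTerm m k = (+ (m C k)) • mono k (m ∸ k)

-- The coefficients of (x + y)^m = Σₖ binomialTerm m k; the k-th term only lives in x-degree k.
binomialP : ℕ → Poly
binomialP m i j = binomialTerm m i i j

binomialTerm-off : ∀ {m k i j} → k ≢ i → binomialTerm m k i j ≡ 0ℤ
binomialTerm-off {m} {k} {i} {j} k≢i =
  trans (cong (+ (m C k) *_) (mono-off {k} {m ∸ k} {i} {j} (k≢i ∘ proj₁))) (ℤP.*-zeroʳ (+ (m C k)))

binomialP-hit : ∀ m i j → i ℕ.+ j ≡ m → binomialP m i j ≡ + (m C i)
binomialP-hit .(i ℕ.+ j) i j refl rewrite m+n∸m≡n i j | mono-diag i j = ℤP.*-identityʳ _

binomialP-miss : ∀ m i j → i ℕ.+ j ≢ m → binomialP m i j ≡ 0ℤ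
binomialP-miss m i j i+j≢m with i ≤? m
... | yes i≤m = trans (cong (+ (m C i) *_) (mono-off {i} {m ∸ i} {i} {j} λ (_ , m∸i≡j) →
                              i+j≢m (trans (cong (i ℕ.+_) (sym m∸i≡j)) (m+[n∸m]≡n i≤m))))
                      (ℤP.*-zeroʳ (+ (m C i)))
... | no  i≰m rewrite k>n⇒nCk≡0 (≰⇒> i≰m) = refl

IsPoly-binomialP : ∀ m → IsPoly (binomialP m)
IsPoly-binomialP m = m , λ i j m<i+j → binomialP-miss m i j λ i+j≡m → ℕP.<-irrefl (sym i+j≡m) m<i+j

*P-distribʳ : ∀ f g h → (g +P h) *P f ≗₂ (g *P f) +P (h *P f)
*P-distribʳ f g h i j =
  trans (Σ≤-cong i λ {a} _ → trans (Σ≤-cong j λ {b} _ → ℤP.*-distribʳ-+ (f (i ∸ a) (j ∸ b)) (g a b) (h a b))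
                                    (Σ≤-+ j _ _))
        (Σ≤-+ i _ _)

xP-*P-zero : ∀ f j → (xP *P f) 0 j ≡ 0ℤ
xP-*P-zero f j = mono-*P-outside {1} {0} {0} {j} f (inj₁ (s≤s z≤n))

xP-*P-suc : ∀ f i j → (xP *P f) (suc i) j ≡ f i j
xP-*P-suc f i j = mono-*P-inside {1} {0} {suc i} {j} f (s≤s z≤n) z≤n

yP-*P-zero : ∀ f i → (yP *P f) i 0 ≡ 0ℤ
yP-*P-zero f i = mono-*P-outside {0} {1} {i} {0} f (inj₂ (s≤s z≤n))

yP-*P-suc : ∀ f i j → (yP *P f) i (suc j) ≡ f i j
yP-*P-suc f i j = mono-*P-inside {0} {1} {i} {suc j} f z≤n (s≤s z≤n)

pascal : ∀ m → (xP *P binomialP m) +P (yP *P binomialP m) ≗₂ binomialP (suc m)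
pascal m zero zero =
  trans (cong₂ _+_ (xP-*P-zero (binomialP m) 0) (yP-*P-zero (binomialP m) 0)) (sym (binomialP-miss (suc m) 0 0 λ ()))
pascal m zero (suc j) =
  trans (cong₂ _+_ (xP-*P-zero (binomialP m) (suc j)) (yP-*P-suc (binomialP m) 0 j)) (ℤP.+-identityˡ _)
pascal m (suc i) zero =
  trans (cong₂ _+_ (xP-*P-suc (binomialP m) i 0) (yP-*P-zero (binomialP m) (suc i)))
        (trans (ℤP.+-identityʳ _) (edge (i ≟ m)))
  where
  edge : Dec (i ≡ m) → binomialP m i 0 ≡ binomialP (suc m) (suc i) 0
  edge (yes refl) = begin
    binomialP i i 0            ≡⟨ binomialP-hit i i 0 (ℕP.+-identityʳ i) ⟩
    + (i C i)                  ≡⟨ cong +_ (trans (nCn≡1 i) (sym (nCn≡1 (suc i)))) ⟩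
    + (suc i C suc i)          ≡⟨ binomialP-hit (suc i) (suc i) 0 (cong suc (ℕP.+-identityʳ i)) ⟨
    binomialP (suc i) (suc i) 0 ∎
    where open ≡-Reasoning
  edge (no i≢m) = trans (binomialP-miss m i 0 (i≢m ∘ trans (sym (ℕP.+-identityʳ i))))
                        (sym (binomialP-miss (suc m) (suc i) 0 (i≢m ∘ trans (sym (ℕP.+-identityʳ i)) ∘ ℕP.suc-injective)))
pascal m (suc i) (suc j) =
  trans (cong₂ _+_ (xP-*P-suc (binomialP m) i (suc j)) (yP-*P-suc (binomialP m) (suc i) j))
        (interior (i ℕ.+ suc j ≟ m))
  where
  interior : Dec (i ℕ.+ suc j ≡ m) →
             binomialP m i (suc j) + binomialP m (suc i) j ≡ binomialP (suc m) (suc i) (suc j)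
  interior (yes refl) = begin
    binomialP m i (suc j) + binomialP m (suc i) j    ≡⟨ cong₂ _+_ (binomialP-hit m i (suc j) refl) (binomialP-hit m (suc i) j (sym (ℕP.+-suc i j))) ⟩
    + (m C i) + + (m C suc i)                        ≡⟨ cong +_ (nCk+nC[k+1]≡[n+1]C[k+1] m i) ⟩
    + (suc m C suc i)                                ≡⟨ binomialP-hit (suc m) (suc i) (suc j) refl ⟨
    binomialP (suc m) (suc i) (suc j)                ∎
    where open ≡-Reasoning
  interior (no i+1+j≢m) =
    trans (cong₂ _+_ (binomialP-miss m i (suc j) i+1+j≢m) (binomialP-miss m (suc i) j (i+1+j≢m ∘ trans (ℕP.+-suc i j))))
          (sym (binomialP-miss (suc m) (suc i) (suc j) (i+1+j≢m ∘ ℕP.suc-injective)))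

binomial-theorem : ∀ m → powP αxy m ≗₂ binomialP m
binomial-theorem zero    zero    zero    = refl
binomial-theorem zero    zero    (suc j) = refl
binomial-theorem zero    (suc i) j       = refl
binomial-theorem (suc m) i j = begin
  (αxy *P powP αxy m) i j                                 ≡⟨ *P-congʳ αxy (binomial-theorem m) i j ⟩
  (αxy *P binomialP m) i j                                ≡⟨ *P-distribʳ (binomialP m) xP yP i j ⟩
  ((xP *P binomialP m) +P (yP *P binomialP m)) i j        ≡⟨ pascal m i j ⟩
  binomialP (suc m) i j                                   ∎
  where open ≡-Reasoning

ΣP-empty : ∀ {a b} F → b ≤ a → ΣP a b F ≡ zeroP
ΣP-empty F b≤a rewrite ℕP.m≤n⇒m∸n≡0 b≤a = refl

-- ΣP recurses on the length b ∸ a of the range, so it unfolds on ranges written [a, d + a).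
ΣP-unfold : ∀ F a d → ΣP a (suc d ℕ.+ a) F ≡ F a +P ΣP (suc a) (d ℕ.+ suc a) F
ΣP-unfold F a d rewrite ℕP.m+n∸n≡m (suc d) a | ℕP.m+n∸n≡m d (suc a) = refl

module _ (F : ℕ → Poly) {i j : ℕ} (off-diagonal : ∀ {k} → k ≢ i → F k i j ≡ 0ℤ) where

  private
    unfold : ∀ a d → ΣP a (suc d ℕ.+ a) F i j ≡ F a i j + ΣP (suc a) (d ℕ.+ suc a) F i j
    unfold a d = cong (λ P → P i j) (ΣP-unfold F a d)

    outside : ∀ d {a} → i < a ⊎ d ℕ.+ a ≤ i → ΣP a (d ℕ.+ a) F i j ≡ 0ℤ
    outside zero {a} _ = cong (λ P → P i j) (ΣP-empty {a} F ≤-refl)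
    outside (suc d) {a} out = trans (unfold a d) (cong₂ _+_ (off-diagonal a≢i) (outside d out′))
      where
      a≢i : a ≢ i
      a≢i refl = [ ℕP.<-irrefl refl , <⇒≱ (ℕP.m<n+m i (s≤s z≤n)) ] out
      out′ : i < suc a ⊎ d ℕ.+ suc a ≤ i
      out′ = Sum.map ℕP.m<n⇒m<1+n (subst (_≤ i) (sym (ℕP.+-suc d a))) out

    inside : ∀ d {a} → a ≤ i → i < d ℕ.+ a → ΣP a (d ℕ.+ a) F i j ≡ F i i j
    inside zero    a≤i i<a = ⊥-elim (<⇒≱ i<a a≤i)
    inside (suc d) {a} a≤i i<1+d+a with a ≟ i
    ... | yes refl = trans (unfold a d) (trans (cong (λ z → F i i j + z) (outside d (inj₁ (ℕP.n<1+n i))))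
                                               (ℤP.+-identityʳ _))
    ... | no  a≢i  = trans (unfold a d) (trans (cong₂ _+_ (off-diagonal a≢i)
                                                          (inside d (≤∧≢⇒< a≤i a≢i) (subst (i <_) (sym (ℕP.+-suc d a)) i<1+d+a)))
                                               (ℤP.+-identityˡ _))

  ΣP-outside : ∀ {a b} → i < a ⊎ b ≤ i → ΣP a b F i j ≡ 0ℤ
  ΣP-outside {a} {b} out with a ≤? b
  ... | no  a≰b = cong (λ P → P i j) (ΣP-empty {a} F (ℕP.<⇒≤ (≰⇒> a≰b)))
  ... | yes a≤b = subst (λ b → ΣP a b F i j ≡ 0ℤ) (m∸n+n≡m a≤b)
                        (outside (b ∸ a) (Sum.map₂ (subst (_≤ i) (sym (m∸n+n≡m a≤b))) out))

  ΣP-inside : ∀ {a b} → a ≤ i → i < b → ΣP a b F i j ≡ F i i j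
  ΣP-inside {a} {b} a≤i i<b = subst (λ b → ΣP a b F i j ≡ F i i j) (m∸n+n≡m a≤b)
                                    (inside (b ∸ a) a≤i (subst (i <_) (sym (m∸n+n≡m a≤b)) i<b))
    where
    a≤b : a ≤ b
    a≤b = ℕP.≤-trans a≤i (ℕP.<⇒≤ i<b)

module Ψ (m μ₁ : ℕ) where

  ψ₁ ψ₂ : Poly
  ψ₁ = proj₁ (ψ m μ₁)
  ψ₂ = proj₂ (ψ m μ₁)

  ψ₁-below : i < μ₁ → ψ₁ i j ≡ 0ℤ
  ψ₁-below i<μ₁ = ΣP-outside (binomialTerm m) binomialTerm-off {μ₁} {suc m} (inj₁ i<μ₁)

  ψ₁-above : μ₁ ≤ i → ψ₁ i j ≡ binomialP m i j
  ψ₁-above {i} {j} μ₁≤i with i ≤? m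
  ... | yes i≤m = ΣP-inside (binomialTerm m) binomialTerm-off {μ₁} {suc m} μ₁≤i (s≤s i≤m)
  ... | no  i≰m = trans (ΣP-outside (binomialTerm m) binomialTerm-off {μ₁} {suc m} (inj₂ (≰⇒> i≰m)))
                        (sym (binomialP-miss m i j λ i+j≡m → i≰m (subst (i ≤_) i+j≡m (ℕP.m≤m+n i j))))

  ψ₂-below : i < μ₁ → ψ₂ i j ≡ binomialP m i j
  ψ₂-below i<μ₁ = ΣP-inside (binomialTerm m) binomialTerm-off {0} {μ₁} z≤n i<μ₁

  ψ₂-above : μ₁ ≤ i → ψ₂ i j ≡ 0ℤ
  ψ₂-above μ₁≤i = ΣP-outside (binomialTerm m) binomialTerm-off {0} {μ₁} (inj₂ μ₁≤i)

  ψ₁+ψ₂≗binomialP : ψ₁ +P ψ₂ ≗₂ binomialP m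
  ψ₁+ψ₂≗binomialP i j with μ₁ ≤? i
  ... | yes μ₁≤i = trans (cong₂ _+_ (ψ₁-above μ₁≤i) (ψ₂-above μ₁≤i)) (ℤP.+-identityʳ _)
  ... | no  μ₁≰i = trans (cong₂ _+_ (ψ₁-below (≰⇒> μ₁≰i)) (ψ₂-below (≰⇒> μ₁≰i))) (ℤP.+-identityˡ _)

  *P-binomialP-split : ∀ f → f *P binomialP m ≗₂ (f *P ψ₁) +P (f *P ψ₂)
  *P-binomialP-split f i j =
    trans (*P-congʳ f (λ a b → sym (ψ₁+ψ₂≗binomialP a b)) i j) (*P-distribˡ f ψ₁ ψ₂ i j)

  IsPoly-ψ₁ : IsPoly ψ₁
  IsPoly-ψ₁ = IsPoly-dominated (IsPoly-binomialP m) λ i j → case μ₁ ≤? i of λ where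
    (yes μ₁≤i) → inj₂ (ψ₁-above μ₁≤i)
    (no  μ₁≰i) → inj₁ (ψ₁-below (≰⇒> μ₁≰i))

  IsPoly-ψ₂ : IsPoly ψ₂
  IsPoly-ψ₂ = IsPoly-dominated (IsPoly-binomialP m) λ i j → case μ₁ ≤? i of λ where
    (yes μ₁≤i) → inj₁ (ψ₂-above μ₁≤i)
    (no  μ₁≰i) → inj₂ (ψ₂-below (≰⇒> μ₁≰i))

-- Congruence modulo p

module _ (p : ℕ) where

  infix 4 _≡ₚ_ _≈ₚ_

  -- A record, unlike Defs' relation, so that x and y can be inferred from x ≡ₚ y.
  record _≡ₚ_ (x y : ℤ) : Set where
    constructor p∣-
    field
      p∣x-y : + p ℤˢ.∣ x - y

  open _≡ₚ_

  _≈ₚ_ : Poly → Poly → Set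
  f ≈ₚ g = ∀ i j → f i j ≡ₚ g i j

  ≈⇒≈ₚ : ∀ {f g} → f ≈[ p ] g → f ≈ₚ g
  ≈⇒≈ₚ f≈g i j = p∣- (∣ᵤ⇒∣ (f≈g i j))

  ≈ₚ⇒≈ : ∀ {f g} → f ≈ₚ g → f ≈[ p ] g
  ≈ₚ⇒≈ f≈ₚg i j = ∣⇒∣ᵤ (p∣x-y (f≈ₚg i j))

  private
    variable
      x x′ y y′ z : ℤ

    along : ∀ {u} → u ≡ x - y → + p ℤˢ.∣ u → x ≡ₚ y
    along u≡x-y p∣u = p∣- (subst (+ p ℤˢ.∣_) u≡x-y p∣u)

  ≡ₚ-refl : x ≡ₚ x
  ≡ₚ-refl {x} = along (sym (ℤP.+-inverseʳ x)) (ℤˢ.divides 0ℤ refl)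

  ≡⇒≡ₚ : x ≡ y → x ≡ₚ y
  ≡⇒≡ₚ refl = ≡ₚ-refl

  ≡ₚ-sym : x ≡ₚ y → y ≡ₚ x
  ≡ₚ-sym {x} {y} (p∣- p∣x-y) = along (identity x y) (ℤˢ.∣m⇒∣-m p∣x-y)
    where
    identity : ∀ x y → - (x - y) ≡ y - x
    identity = solve-∀

  ≡ₚ-trans : x ≡ₚ y → y ≡ₚ z → x ≡ₚ z
  ≡ₚ-trans {x} {y} {z} (p∣- p∣x-y) (p∣- p∣y-z) = along (identity x y z) (ℤˢ.∣m∣n⇒∣m+n p∣x-y p∣y-z)
    where
    identity : ∀ x y z → (x - y) + (y - z) ≡ x - z
    identity = solve-∀

  +-congₚ : x ≡ₚ x′ → y ≡ₚ y′ → x + y ≡ₚ x′ + y′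
  +-congₚ {x} {x′} {y} {y′} (p∣- p∣x-x′) (p∣- p∣y-y′) =
    along (identity x x′ y y′) (ℤˢ.∣m∣n⇒∣m+n p∣x-x′ p∣y-y′)
    where
    identity : ∀ x x′ y y′ → (x - x′) + (y - y′) ≡ (x + y) - (x′ + y′)
    identity = solve-∀

  neg-congₚ : x ≡ₚ y → - x ≡ₚ - y
  neg-congₚ {x} {y} (p∣- p∣x-y) = along (identity x y) (ℤˢ.∣m⇒∣-m p∣x-y)
    where
    identity : ∀ x y → - (x - y) ≡ - x - - y
    identity = solve-∀

  *-congₚ : x ≡ₚ x′ → y ≡ₚ y′ → x * y ≡ₚ x′ * y′
  *-congₚ {x} {x′} {y} {y′} (p∣- p∣x-x′) (p∣- p∣y-y′) =
    along (identity x x′ y y′) (ℤˢ.∣m∣n⇒∣m+n (ℤˢ.∣n⇒∣m*n x p∣y-y′) (ℤˢ.∣m⇒∣m*n y′ p∣x-x′))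
    where
    identity : ∀ x x′ y y′ → x * (y - y′) + (x - x′) * y′ ≡ x * y - x′ * y′
    identity = solve-∀

  ≡ₚ-setoid : Setoid 0ℓ 0ℓ
  ≡ₚ-setoid = record
    { Carrier       = ℤ
    ; _≈_           = _≡ₚ_
    ; isEquivalence = record { refl = ≡ₚ-refl ; sym = ≡ₚ-sym ; trans = ≡ₚ-trans }
    }

  module ≡ₚ-Reasoning = SetoidReasoning ≡ₚ-setoid

  +-congˡₚ : ∀ x → y ≡ₚ y′ → x + y ≡ₚ x + y′
  +-congˡₚ x = +-congₚ (≡ₚ-refl {x})

  +-congʳₚ : ∀ y → x ≡ₚ x′ → x + y ≡ₚ x′ + y
  +-congʳₚ y x≡ₚx′ = +-congₚ x≡ₚx′ (≡ₚ-refl {y})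

  *-zeroʳₚ : ∀ x → y ≡ₚ 0ℤ → x * y ≡ₚ 0ℤ
  *-zeroʳₚ x y≡ₚ0 = ≡ₚ-trans (*-congₚ (≡ₚ-refl {x}) y≡ₚ0) (≡⇒≡ₚ (ℤP.*-zeroʳ x))

  *-zeroˡₚ : ∀ y → x ≡ₚ 0ℤ → x * y ≡ₚ 0ℤ
  *-zeroˡₚ y x≡ₚ0 = *-congₚ x≡ₚ0 (≡ₚ-refl {y})

  Σ≤-congₚ : ∀ n {u v : ℕ → ℤ} → (∀ {k} → k ≤ n → u k ≡ₚ v k) → Σ≤ n u ≡ₚ Σ≤ n v
  Σ≤-congₚ zero    u≡ₚv = u≡ₚv z≤n
  Σ≤-congₚ (suc n) u≡ₚv = +-congₚ (Σ≤-congₚ n (u≡ₚv ∘ m≤n⇒m≤1+n)) (u≡ₚv ≤-refl)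

  Σ≤-zeroₚ : ∀ n {u : ℕ → ℤ} → (∀ {k} → k ≤ n → u k ≡ₚ 0ℤ) → Σ≤ n u ≡ₚ 0ℤ
  Σ≤-zeroₚ n u≡ₚ0 = ≡ₚ-trans (Σ≤-congₚ n u≡ₚ0) (≡⇒≡ₚ (Σ≤-zero n λ _ → refl))

  Σ≤-lastₚ : ∀ n {u : ℕ → ℤ} → (∀ {k} → k < n → u k ≡ₚ 0ℤ) → Σ≤ n u ≡ₚ u n
  Σ≤-lastₚ zero    _    = ≡ₚ-refl
  Σ≤-lastₚ (suc n) u≡ₚ0 =
    ≡ₚ-trans (+-congₚ (Σ≤-zeroₚ n (u≡ₚ0 ∘ s≤s)) ≡ₚ-refl) (≡⇒≡ₚ (ℤP.+-identityˡ _))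

  +≡ₚ0⇒≡ₚ- : ∀ x y → x + y ≡ₚ 0ℤ → x ≡ₚ - y
  +≡ₚ0⇒≡ₚ- x y x+y≡ₚ0 =
    ≡ₚ-trans (≡⇒≡ₚ (identity x y))
             (≡ₚ-trans (+-congₚ x+y≡ₚ0 (≡ₚ-refl { - y})) (≡⇒≡ₚ (ℤP.+-identityˡ (- y))))
    where
    identity : ∀ x y → x ≡ (x + y) + - y
    identity = solve-∀

  +≡ₚ0⇔∣ : + n ≡ₚ 0ℤ ⇔ p ∣ n
  +≡ₚ0⇔∣ {n} = mk⇔ (λ (p∣- p∣n-0) → ∣⇒∣ᵤ (subst (+ p ℤˢ.∣_) n-0≡n p∣n-0))
                   (λ p∣n → p∣- (subst (+ p ℤˢ.∣_) (sym n-0≡n) (∣ᵤ⇒∣ p∣n)))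
    where
    n-0≡n : + n - 0ℤ ≡ + n
    n-0≡n = ℤP.+-identityʳ (+ n)

  *P-zeroˡₚ : ∀ g → f ≈ₚ zeroP → f *P g ≈ₚ zeroP
  *P-zeroˡₚ {f} g f≈ₚ0 i j =
    Σ≤-zeroₚ i λ {a} _ → Σ≤-zeroₚ j λ {b} _ → *-zeroˡₚ (g (i ∸ a) (j ∸ b)) (f≈ₚ0 a b)

  -≈ₚ⇒≈ₚ+ : ∀ f g → f +P negP g ≈ₚ h → f ≈ₚ g +P h
  -≈ₚ⇒≈ₚ+ {h} f g f-g≈ₚh i j = ≡ₚ-trans (≡⇒≡ₚ (split (f i j) (g i j))) (+-congˡₚ (g i j) (f-g≈ₚh i j))
    where
    split : ∀ a b → a ≡ b + (a - b)
    split = solve-∀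

  -- Divisibility by monomials

  infix 4 x^_y^_∣_
  x^_y^_∣_ : ℕ → ℕ → Poly → Set
  x^ a y^ b ∣ h = ∀ i j → i < a ⊎ j < b → h i j ≡ₚ 0ℤ

  ∣-*P : ∀ f → x^ a y^ b ∣ g → x^ a y^ b ∣ f *P g
  ∣-*P {g = g} f g∣ i j out =
    Σ≤-zeroₚ i λ {k} _ → Σ≤-zeroₚ j λ {l} _ → *-zeroʳₚ (f k l) (g∣ (i ∸ k) (j ∸ l) (shrink k l out))
    where
    shrink : ∀ k l → i < a ⊎ j < b → i ∸ k < a ⊎ j ∸ l < b
    shrink k l = Sum.map (ℕP.≤-<-trans (ℕP.m∸n≤m i k)) (ℕP.≤-<-trans (ℕP.m∸n≤m j l))

  ∣-+P : x^ a y^ b ∣ f → x^ a y^ b ∣ g → x^ a y^ b ∣ f +P g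
  ∣-+P f∣ g∣ i j out = +-congₚ (f∣ i j out) (g∣ i j out)

  ∣-negP : x^ a y^ b ∣ f → x^ a y^ b ∣ negP f
  ∣-negP f∣ i j out = neg-congₚ (f∣ i j out)

  -- g ≡ -f inherits the divisibility by x^a of f.
  ∣-antidiagonal : f +P g ≈ₚ zeroP → x^ a y^ 0 ∣ f → x^ 0 y^ b ∣ g → x^ a y^ b ∣ g
  ∣-antidiagonal {f} {g} f+g≈ₚ0 f∣ g∣ i j (inj₁ i<a) =
    ≡ₚ-trans (+≡ₚ0⇒≡ₚ- (g i j) (f i j) (≡ₚ-trans (≡⇒≡ₚ (ℤP.+-comm (g i j) (f i j))) (f+g≈ₚ0 i j)))
             (neg-congₚ (f∣ i j (inj₁ i<a)))
  ∣-antidiagonal f+g≈ₚ0 f∣ g∣ i j (inj₂ j<b) = g∣ i j (inj₂ j<b)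

  ≈ₚmono*P⇒∣ : h ≈ₚ mono a b *P g → x^ a y^ b ∣ h
  ≈ₚmono*P⇒∣ {a = a} {b} {g = g} h≈ₚ i j out =
    ≡ₚ-trans (h≈ₚ i j) (≡⇒≡ₚ (mono-*P-outside {a} {b} {i} {j} g out))

  ∣⇒≈ₚmono*P : x^ a y^ b ∣ h → h ≈ₚ mono a b *P (h /x^ a y^ b)
  ∣⇒≈ₚmono*P {a} {b} {h} h∣ i j with a ≤? i | b ≤? j
  ... | yes a≤i | yes b≤j = ≡⇒≡ₚ (sym (trans (mono-*P-inside {a} {b} {i} {j} (h /x^ a y^ b) a≤i b≤j)
                                              (cong₂ h (m+[n∸m]≡n a≤i) (m+[n∸m]≡n b≤j))))
  ... | no  a≰i | _       = ≡ₚ-trans (h∣ i j (inj₁ (≰⇒> a≰i)))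
                                     (≡⇒≡ₚ (sym (mono-*P-outside {a} {b} {i} {j} (h /x^ a y^ b) (inj₁ (≰⇒> a≰i)))))
  ... | yes _   | no  b≰j = ≡ₚ-trans (h∣ i j (inj₂ (≰⇒> b≰j)))
                                     (≡⇒≡ₚ (sym (mono-*P-outside {a} {b} {i} {j} (h /x^ a y^ b) (inj₂ (≰⇒> b≰j)))))

  module _ (α : Poly) (k : ℕ) {a b : ℕ} (powP-α≗mono : powP α k ≗₂ mono a b) where

    InIdeal⇒∣ : InIdeal p α k h → x^ a y^ b ∣ h
    InIdeal⇒∣ {h} (g , _ , h≈α^kg) =
      ≈ₚmono*P⇒∣ {g = g} λ i j →
        ≡ₚ-trans (≈⇒≈ₚ {h} {powP α k *P g} h≈α^kg i j) (≡⇒≡ₚ (*P-congˡ g powP-α≗mono i j))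

    ∣⇒InIdeal : IsPoly h → x^ a y^ b ∣ h → InIdeal p α k h
    ∣⇒InIdeal {h} h-poly h∣ = h /x^ a y^ b , IsPoly-/x^y^ h-poly , ≈ₚ⇒≈ λ i j →
      ≡ₚ-trans (∣⇒≈ₚmono*P h∣ i j) (≡⇒≡ₚ (sym (*P-congˡ (h /x^ a y^ b) powP-α≗mono i j)))

  InIdeal-xP⇒∣ : InIdeal p xP a h → x^ a y^ 0 ∣ h
  InIdeal-xP⇒∣ {a} = InIdeal⇒∣ xP a (powP-xP a)

  InIdeal-yP⇒∣ : InIdeal p yP b h → x^ 0 y^ b ∣ h
  InIdeal-yP⇒∣ {b} = InIdeal⇒∣ yP b (powP-yP b)

  ∣⇒InIdeal-xP : IsPoly h → x^ a y^ 0 ∣ h → InIdeal p xP a h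
  ∣⇒InIdeal-xP {a = a} = ∣⇒InIdeal xP a (powP-xP a)

  ∣⇒InIdeal-yP : IsPoly h → x^ 0 y^ b ∣ h → InIdeal p yP b h
  ∣⇒InIdeal-yP {b = b} = ∣⇒InIdeal yP b (powP-yP b)

  *P-mono-cancelʳ : ∀ a b → g *P mono a b ≈ₚ zeroP → g ≈ₚ zeroP
  *P-mono-cancelʳ {g} a b g·mono≈ₚ0 i j = ≡ₚ-trans (≡⇒≡ₚ g≡) (g·mono≈ₚ0 (a ℕ.+ i) (b ℕ.+ j))
    where
    open ≡-Reasoning
    g≡ : g i j ≡ (g *P mono a b) (a ℕ.+ i) (b ℕ.+ j)
    g≡ = begin
      g i j                                              ≡⟨ cong₂ g (m+n∸m≡n a i) (m+n∸m≡n b j) ⟨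
      g (a ℕ.+ i ∸ a) (b ℕ.+ j ∸ b)                      ≡⟨ mono-*P-inside g (ℕP.m≤m+n a i) (ℕP.m≤m+n b j) ⟨
      (mono a b *P g) (a ℕ.+ i) (b ℕ.+ j)                ≡⟨ *P-comm (mono a b) g (a ℕ.+ i) (b ℕ.+ j) ⟩
      (g *P mono a b) (a ℕ.+ i) (b ℕ.+ j)                ∎

  -- Q is not a zero divisor once its x-free part Q(0, y) is the monomial y^m: the coefficient of
  -- x^i y^(j+m) in f Q is f i j plus terms involving only rows of f below i.
  *P-cancelʳ : ∀ m {Q} → Q 0 m ≡ 1ℤ → (∀ {l} → l ≢ m → Q 0 l ≡ 0ℤ) →
               f *P Q ≈ₚ zeroP → f ≈ₚ zeroP
  *P-cancelʳ {f} m {Q} Q0m≡1 Q0l≡0 fQ≈ₚ0 i j = <-rec (λ i → ∀ j → f i j ≡ₚ 0ℤ) vanishes i j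
    where
    row : ℕ → ℕ → ℕ → ℤ
    row i j k = Σ≤ (j ℕ.+ m) λ l → f k l * Q (i ∸ k) (j ℕ.+ m ∸ l)

    diagonal-row : ∀ i j → row i j i ≡ f i j
    diagonal-row i j = begin
      row i j i                            ≡⟨ Σ≤-single (j ℕ.+ m) (ℕP.m≤m+n j m) off ⟩
      f i j * Q (i ∸ i) (j ℕ.+ m ∸ j)      ≡⟨ cong₂ (λ a b → f i j * Q a b) (ℕP.n∸n≡0 i) (m+n∸m≡n j m) ⟩
      f i j * Q 0 m                        ≡⟨ cong (f i j *_) Q0m≡1 ⟩
      f i j * 1ℤ                           ≡⟨ ℤP.*-identityʳ (f i j) ⟩
      f i j                                ∎
      where
      open ≡-Reasoning
      off : l ≤ j ℕ.+ m → l ≢ j → f i l * Q (i ∸ i) (j ℕ.+ m ∸ l) ≡ 0ℤ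
      off {l} l≤j+m l≢j rewrite ℕP.n∸n≡0 i = trans (cong (f i l *_) (Q0l≡0 j+m-l≢m)) (ℤP.*-zeroʳ (f i l))
        where
        j+m-l≢m : j ℕ.+ m ∸ l ≢ m
        j+m-l≢m j+m-l≡m = l≢j (ℕP.+-cancelʳ-≡ m l j (begin
          l ℕ.+ m                  ≡⟨ cong (l ℕ.+_) j+m-l≡m ⟨
          l ℕ.+ (j ℕ.+ m ∸ l)      ≡⟨ m+[n∸m]≡n l≤j+m ⟩
          j ℕ.+ m                  ∎))

    vanishes : ∀ i → (∀ {i′} → i′ < i → ∀ j → f i′ j ≡ₚ 0ℤ) → ∀ j → f i j ≡ₚ 0ℤ
    vanishes i earlier-rows j = begin
      f i j                      ≡⟨ diagonal-row i j ⟨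
      row i j i                  ≈⟨ Σ≤-lastₚ i (λ k<i → Σ≤-zeroₚ (j ℕ.+ m) λ {l} _ → *-zeroˡₚ _ (earlier-rows k<i l)) ⟨
      Σ≤ i (row i j)             ≈⟨ fQ≈ₚ0 i (j ℕ.+ m) ⟩
      0ℤ                         ∎
      where open ≡ₚ-Reasoning

  -- The basis {ψ_μ, ψ'_μ}

  module _ (m μ₁ μ₂ : ℕ) where
    open Ψ m μ₁

    -- The condition over J_μ, with m - μ₂ < j restated in ℕ.
    BinomialsVanish : Set
    BinomialsVanish = ∀ j → m < j ℕ.+ μ₂ → j < μ₁ → p ∣ m C j

    X : Poly
    X = powP xP μ₁ *P powP yP μ₂

    y^μ₂∣ψ₂⇔BinomialsVanish : x^ 0 y^ μ₂ ∣ ψ₂ ⇔ BinomialsVanish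
    y^μ₂∣ψ₂⇔BinomialsVanish = mk⇔ to from
      where
      to : x^ 0 y^ μ₂ ∣ ψ₂ → BinomialsVanish
      to ψ₂∣ j m<j+μ₂ j<μ₁ with j ≤? m
      ... | no  j≰m rewrite k>n⇒nCk≡0 (≰⇒> j≰m) = p ∣0
      ... | yes j≤m = Equivalence.to +≡ₚ0⇔∣ (begin
        + (m C j)               ≡⟨ binomialP-hit m j (m ∸ j) (m+[n∸m]≡n j≤m) ⟨
        binomialP m j (m ∸ j)   ≡⟨ ψ₂-below j<μ₁ ⟨
        ψ₂ j (m ∸ j)            ≈⟨ ψ₂∣ j (m ∸ j) (inj₂ m∸j<μ₂) ⟩
        0ℤ                      ∎)
        where
        open ≡ₚ-Reasoning
        m∸j<μ₂ : m ∸ j < μ₂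
        m∸j<μ₂ = ℕP.+-cancelˡ-< j (m ∸ j) μ₂ (subst (_< j ℕ.+ μ₂) (sym (m+[n∸m]≡n j≤m)) m<j+μ₂)

      from : BinomialsVanish → x^ 0 y^ μ₂ ∣ ψ₂
      from vanish i j (inj₁ ())
      from vanish i j (inj₂ j<μ₂) with μ₁ ≤? i
      ... | yes μ₁≤i = ≡⇒≡ₚ (ψ₂-above μ₁≤i)
      ... | no  μ₁≰i with i ℕ.+ j ≟ m
      ...   | yes i+j≡m = ≡ₚ-trans (≡⇒≡ₚ (trans (ψ₂-below (≰⇒> μ₁≰i)) (binomialP-hit m i j i+j≡m)))
                                   (Equivalence.from +≡ₚ0⇔∣ (vanish i m<i+μ₂ (≰⇒> μ₁≰i)))
        where
        m<i+μ₂ : m < i ℕ.+ μ₂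
        m<i+μ₂ = subst (_< i ℕ.+ μ₂) i+j≡m (ℕP.+-monoʳ-< i j<μ₂)
      ...   | no  i+j≢m = ≡⇒≡ₚ (trans (ψ₂-below (≰⇒> μ₁≰i)) (binomialP-miss m i j i+j≢m))

    x^μ₁∣ψ₁ : x^ μ₁ y^ 0 ∣ ψ₁
    x^μ₁∣ψ₁ i j (inj₁ i<μ₁) = ≡⇒≡ₚ (ψ₁-below i<μ₁)
    x^μ₁∣ψ₁ i j (inj₂ ())

    ψ∈D : BinomialsVanish → InD p μ₁ μ₂ m (ψ m μ₁)
    ψ∈D vanish =
      (IsPoly-ψ₁ , IsPoly-ψ₂) ,
      ∣⇒InIdeal-xP IsPoly-ψ₁ x^μ₁∣ψ₁ ,
      ∣⇒InIdeal-yP IsPoly-ψ₂ (Equivalence.from y^μ₂∣ψ₂⇔BinomialsVanish vanish) ,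
      (oneP , IsPoly-mono 0 0 , ≈ₚ⇒≈ λ i j → ≡⇒≡ₚ (begin
        (ψ₁ +P ψ₂) i j               ≡⟨ ψ₁+ψ₂≗binomialP i j ⟩
        binomialP m i j              ≡⟨ binomial-theorem m i j ⟨
        powP αxy m i j               ≡⟨ *P-identityʳ (powP αxy m) i j ⟨
        (powP αxy m *P oneP) i j     ∎))
      where open ≡-Reasoning

    IsPoly-X : IsPoly X
    IsPoly-X = IsPoly-resp (λ i j → sym (powP-xP-*P-powP-yP μ₁ μ₂ i j)) (IsPoly-mono μ₁ μ₂)

    X-outside : ∀ i j → i < μ₁ ⊎ j < μ₂ → X i j ≡ 0ℤ
    X-outside i j out =
      trans (powP-xP-*P-powP-yP μ₁ μ₂ i j) (mono-off {μ₁} {μ₂} {i} {j} λ { (refl , refl) → off-diagonal out })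
      where
      off-diagonal : i < i ⊎ j < j → ⊥
      off-diagonal = [ ℕP.<-irrefl refl , ℕP.<-irrefl refl ]

    ψ'∈D : InD p μ₁ μ₂ m (ψ' μ₁ μ₂)
    ψ'∈D =
      (IsPoly-negP IsPoly-X , IsPoly-X) ,
      ∣⇒InIdeal-xP (IsPoly-negP IsPoly-X) (λ where
        i j (inj₁ i<μ₁) → ≡⇒≡ₚ (cong -_ (X-outside i j (inj₁ i<μ₁)))
        i j (inj₂ ())) ,
      ∣⇒InIdeal-yP IsPoly-X (λ where
        i j (inj₁ ())
        i j (inj₂ j<μ₂) → ≡⇒≡ₚ (X-outside i j (inj₂ j<μ₂))) ,
      (zeroP , (0 , λ _ _ _ → refl) , ≈ₚ⇒≈ λ i j →
        ≡⇒≡ₚ (trans (ℤP.+-inverseˡ (X i j)) (sym (*P-zeroʳ (powP αxy m) i j))))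

    ψ'-multiple : ∀ {θ₁ θ₂} → θ₁ +P θ₂ ≈ₚ zeroP → x^ μ₁ y^ 0 ∣ θ₁ → x^ 0 y^ μ₂ ∣ θ₂ →
                  (θ₁ ≈ₚ (θ₂ /x^ μ₁ y^ μ₂) *P negP X) × (θ₂ ≈ₚ (θ₂ /x^ μ₁ y^ μ₂) *P X)
    ψ'-multiple {θ₁} {θ₂} θ₁+θ₂≈ₚ0 x^μ₁∣θ₁ y^μ₂∣θ₂ = θ₁≈ₚ-GX , θ₂≈ₚGX
      where
      G : Poly
      G = θ₂ /x^ μ₁ y^ μ₂

      θ₂≈ₚGX : θ₂ ≈ₚ G *P X
      θ₂≈ₚGX i j = ≡ₚ-trans (∣⇒≈ₚmono*P (∣-antidiagonal {θ₁} {θ₂} θ₁+θ₂≈ₚ0 x^μ₁∣θ₁ y^μ₂∣θ₂) i j)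
                            (≡⇒≡ₚ (trans (*P-comm (mono μ₁ μ₂) G i j) (sym (*P-congʳ G (powP-xP-*P-powP-yP μ₁ μ₂) i j))))

      θ₁≈ₚ-GX : θ₁ ≈ₚ G *P negP X
      θ₁≈ₚ-GX i j = ≡ₚ-trans (+≡ₚ0⇒≡ₚ- (θ₁ i j) (θ₂ i j) (θ₁+θ₂≈ₚ0 i j))
                             (≡ₚ-trans (neg-congₚ (θ₂≈ₚGX i j)) (≡⇒≡ₚ (sym (*P-negʳ G X i j))))

    spanned : BinomialsVanish → ∀ η → InD p μ₁ μ₂ m η →
              ∃ λ f → ∃ λ g → IsPoly f × IsPoly g × (η ≈D[ p ] lin f (ψ m μ₁) g (ψ' μ₁ μ₂))
    spanned vanish (η₁ , η₂) ((_ , η₂-poly) , η₁∈x^μ₁S , η₂∈y^μ₂S , (h , h-poly , η₁+η₂≈α^mh)) =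
      h , θ₂ /x^ μ₁ y^ μ₂ , h-poly , IsPoly-/x^y^ θ₂-poly ,
      ≈ₚ⇒≈ (-≈ₚ⇒≈ₚ+ η₁ (h *P ψ₁) (proj₁ θ≈ₚGψ')) , ≈ₚ⇒≈ (-≈ₚ⇒≈ₚ+ η₂ (h *P ψ₂) (proj₂ θ≈ₚGψ'))
      where
      θ₁ θ₂ : Poly
      θ₁ = η₁ +P negP (h *P ψ₁)
      θ₂ = η₂ +P negP (h *P ψ₂)

      θ₂-poly : IsPoly θ₂
      θ₂-poly = IsPoly-+P η₂-poly (IsPoly-negP (IsPoly-*P h-poly IsPoly-ψ₂))

      θ₁+θ₂≈ₚ0 : θ₁ +P θ₂ ≈ₚ zeroP
      θ₁+θ₂≈ₚ0 i j = begin
        θ₁ i j + θ₂ i j                      ≡⟨ regroup (η₁ i j) (η₂ i j) hψ₁ hψ₂ ⟩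
        (η₁ i j + η₂ i j) - (hψ₁ + hψ₂)      ≈⟨ +-congʳₚ (- (hψ₁ + hψ₂)) (≈⇒≈ₚ {η₁ +P η₂} η₁+η₂≈α^mh i j) ⟩
        (powP αxy m *P h) i j - (hψ₁ + hψ₂)  ≡⟨ cong (_- (hψ₁ + hψ₂)) α^mh≡hψ₁+hψ₂ ⟩
        (hψ₁ + hψ₂) - (hψ₁ + hψ₂)            ≡⟨ ℤP.+-inverseʳ (hψ₁ + hψ₂) ⟩
        0ℤ                                   ∎
        where
        open ≡ₚ-Reasoning
        hψ₁ hψ₂ : ℤ
        hψ₁ = (h *P ψ₁) i j
        hψ₂ = (h *P ψ₂) i j
        α^mh≡hψ₁+hψ₂ : (powP αxy m *P h) i j ≡ hψ₁ + hψ₂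
        α^mh≡hψ₁+hψ₂ = trans (*P-comm (powP αxy m) h i j)
                        (trans (*P-congʳ h (binomial-theorem m) i j) (*P-binomialP-split h i j))
        regroup : ∀ a b c d → (a + - c) + (b + - d) ≡ (a + b) - (c + d)
        regroup = solve-∀

      θ≈ₚGψ' : (θ₁ ≈ₚ (θ₂ /x^ μ₁ y^ μ₂) *P negP X) × (θ₂ ≈ₚ (θ₂ /x^ μ₁ y^ μ₂) *P X)
      θ≈ₚGψ' = ψ'-multiple {θ₁} {θ₂} θ₁+θ₂≈ₚ0
        (∣-+P (InIdeal-xP⇒∣ {h = η₁} η₁∈x^μ₁S) (∣-negP (∣-*P h x^μ₁∣ψ₁)))
        (∣-+P (InIdeal-yP⇒∣ {h = η₂} η₂∈y^μ₂S)
              (∣-negP (∣-*P h (Equivalence.from y^μ₂∣ψ₂⇔BinomialsVanish vanish))))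

    θxy-lin-ψ-ψ' : ∀ f g → θxy (lin f (ψ m μ₁) g (ψ' μ₁ μ₂)) ≗₂ f *P binomialP m
    θxy-lin-ψ-ψ' f g i j = begin
      (fψ₁ + (g *P negP X) i j) + (fψ₂ + gX)   ≡⟨ cong (λ z → (fψ₁ + z) + (fψ₂ + gX)) (*P-negʳ g X i j) ⟩
      (fψ₁ + - gX) + (fψ₂ + gX)               ≡⟨ regroup fψ₁ fψ₂ gX ⟨
      fψ₁ + fψ₂                               ≡⟨ *P-binomialP-split f i j ⟨
      (f *P binomialP m) i j                  ∎
      where
      open ≡-Reasoning
      fψ₁ fψ₂ gX : ℤ
      fψ₁ = (f *P ψ₁) i j
      fψ₂ = (f *P ψ₂) i j
      gX  = (g *P X) i j
      regroup : ∀ a b c → a + b ≡ (a + - c) + (b + c)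
      regroup = solve-∀

    independent : ∀ f g → IsPoly f → IsPoly g →
                  lin f (ψ m μ₁) g (ψ' μ₁ μ₂) ≈D[ p ] (zeroP , zeroP) → (f ≈[ p ] zeroP) × (g ≈[ p ] zeroP)
    independent f g _ _ (fψ₁-gX≈0 , fψ₂+gX≈0) = ≈ₚ⇒≈ f≈ₚ0 , ≈ₚ⇒≈ g≈ₚ0
      where
      open ≡ₚ-Reasoning
      fψ₁-gX≈ₚ0 : (f *P ψ₁) +P (g *P negP X) ≈ₚ zeroP
      fψ₁-gX≈ₚ0 = ≈⇒≈ₚ {(f *P ψ₁) +P (g *P negP X)} {zeroP} fψ₁-gX≈0
      fψ₂+gX≈ₚ0 : (f *P ψ₂) +P (g *P X) ≈ₚ zeroP
      fψ₂+gX≈ₚ0 = ≈⇒≈ₚ {(f *P ψ₂) +P (g *P X)} {zeroP} fψ₂+gX≈0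

      f·binomial≈ₚ0 : f *P binomialP m ≈ₚ zeroP
      f·binomial≈ₚ0 i j =
        ≡ₚ-trans (≡⇒≡ₚ (sym (θxy-lin-ψ-ψ' f g i j))) (+-congₚ (fψ₁-gX≈ₚ0 i j) (fψ₂+gX≈ₚ0 i j))

      f≈ₚ0 : f ≈ₚ zeroP
      f≈ₚ0 = *P-cancelʳ m {binomialP m} (binomialP-hit m 0 m refl) (binomialP-miss m 0 _) f·binomial≈ₚ0

      gX≈ₚ0 : g *P X ≈ₚ zeroP
      gX≈ₚ0 i j = begin
        (g *P X) i j                                     ≡⟨ isolate ((f *P ψ₂) i j) ((g *P X) i j) ⟩
        ((f *P ψ₂) i j + (g *P X) i j) - (f *P ψ₂) i j   ≈⟨ +-congₚ (fψ₂+gX≈ₚ0 i j) (neg-congₚ (*P-zeroˡₚ ψ₂ f≈ₚ0 i j)) ⟩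
        0ℤ                                               ∎
        where
        isolate : ∀ a b → b ≡ (a + b) - a
        isolate = solve-∀

      g≈ₚ0 : g ≈ₚ zeroP
      g≈ₚ0 = *P-mono-cancelʳ μ₁ μ₂ λ i j →
        ≡ₚ-trans (≡⇒≡ₚ (sym (*P-congʳ g (powP-xP-*P-powP-yP μ₁ μ₂) i j))) (gX≈ₚ0 i j)

    InΓ⇔BinomialsVanish : InΓ p m μ₁ μ₂ ⇔ BinomialsVanish
    InΓ⇔BinomialsVanish = mk⇔
      (λ ((_ , _ , ψ₂∈y^μ₂S , _) , _) →
        Equivalence.to y^μ₂∣ψ₂⇔BinomialsVanish (InIdeal-yP⇒∣ {h = ψ₂} ψ₂∈y^μ₂S))
      (λ vanish → ψ∈D vanish , ψ'∈D , spanned vanish , independent)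

m-n<j⇔m<j+n : ∀ m n j → (+ m) - (+ n) ℤ.< (+ j) ⇔ m < j ℕ.+ n
m-n<j⇔m<j+n m n j = mk⇔
  (λ m-n<j → ℤP.drop‿+<+ (subst₂ ℤ._<_ (cancel (+ m) (+ n)) (sym (ℤP.pos-+ j n)) (ℤP.+-monoˡ-< (+ n) m-n<j)))
  (λ m<j+n → subst (λ z → (+ m) - (+ n) ℤ.< z) (uncancel (+ j) (+ n))
                   (ℤP.+-monoˡ-< (- (+ n)) (subst ((+ m) ℤ.<_) (ℤP.pos-+ j n) (ℤ.+<+ m<j+n))))
  where
  cancel : ∀ x y → (x - y) + y ≡ x
  cancel = solve-∀
  uncancel : ∀ x y → (x + y) - y ≡ x
  uncancel = solve-∀

theorem5p3 : ∀ (p : ℕ) → Prime p → ∀ (m : ℕ) → m > 0 → ∀ (μ₁ μ₂ : ℕ) →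
    InΓ p m μ₁ μ₂ ⇔ (∀ (j : ℕ) → (+ m) ℤ.- (+ μ₂) ℤ.< (+ j) → j < μ₁ → p ∣ (m C j))
theorem5p3 p _ m _ μ₁ μ₂ = mk⇔
  (λ Γ j m-μ₂<j → Equivalence.to InΓ⇔vanish Γ j (Equivalence.to (m-n<j⇔m<j+n m μ₂ j) m-μ₂<j))
  (λ vanish → Equivalence.from InΓ⇔vanish λ j m<j+μ₂ → vanish j (Equivalence.from (m-n<j⇔m<j+n m μ₂ j) m<j+μ₂))
  where
  InΓ⇔vanish : InΓ p m μ₁ μ₂ ⇔ BinomialsVanish p m μ₁ μ₂
  InΓ⇔vanish = InΓ⇔BinomialsVanish p m μ₁ μ₂
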